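{- If $\varphi\vdash\psi$ is an $\mathcal{L}_C$-sequent which is not derivable in $\mathbf{L}_C$, then $\mathbb{M}_{\varphi,\psi}\not\models \varphi\vdash\psi$.
   Context: The language $\mathcal{L}_C$ over atoms $\mathsf{Prop}$ and a finite set $\mathsf{Ag}$ of agents is $\varphi ::= \bot \mid \top \mid p \mid \varphi\wedge\varphi \mid \varphi\vee\varphi \mid \Box_i\varphi \mid C(\varphi)$. The logic $\mathbf{L}_C$ contains the axioms $p\vdash p$, $\bot\vdash p$, $p\vdash\top$, $p\vdash p\vee q$, $q\vdash p\vee q$, $p\wedge q\vdash p$, $p\wedge q\vdash q$, $\top\vdash\Box_i\top$, $\Box_i p\wedge\Box_i q\vdash\Box_i(p\wedge q)$, $\top\vdash C(\top)$, $C(p)\wedge C(q)\vdash C(p\wedge q)$, $C(p)\vdash\bigwedge\{\Box_ip\wedge\Box_iC(p)\mid i\in\mathsf{Ag}\}$, and is closed under cut, uniform substitution, $\wedge$-introduction on the right, $\vee$-introduction on the left, monotonicity of each $\Box_i$ and of $C$, and the rule "from $\chi\vdash\bigwedge_{i\in\mathsf{Ag}}\Box_i\varphi$ and $\chi\vdash\Box_i\chi$ for all $i\in\mathsf{Ag}$ infer $\chi\vdash C(\varphi)$". For $S\subseteq A\times X$ let $S^{\uparrow}[B]=\{x\mid \forall a\in B,\ aSx\}$, $S^{\downarrow}[Y]=\{a\mid \forall x\in Y,\ aSx\}$, $B^\uparrow=I^\uparrow[B]$, $Y^\downarrow=I^\downarrow[Y]$, $x^{\downarrow\uparrow}=\{x\}^{\downarrow\uparrow}$.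 A model $((A,X,I),\{R_i\},V)$ assigns to each atom a formal concept $([\![p]\!],(\![p]\!))$ (extension $\subseteq A$, description $\subseteq X$, each the $\downarrow$/$\uparrow$ of the other); this extends by $[\![\top]\!]=A$, $(\![\bot]\!)=X$, $[\![\phi\wedge\psi]\!]=[\![\phi]\!]\cap[\![\psi]\!]$, $(\![\phi\vee\psi]\!)=(\![\phi]\!)\cap(\![\psi]\!)$, $[\![\Box_i\phi]\!]=R_i^\downarrow[(\![\phi]\!)]$, $[\![C(\phi)]\!]=R_C^\downarrow[(\![\phi]\!)]$, where for nonempty finite sequences $s$ of agents $R_i$ is given and $R_{it}^\downarrow[x]=R_i^\downarrow[I^\uparrow[R_t^\downarrow[x^{\downarrow\uparrow}]]]$, and $R_C=\bigcap_s R_s$. $\mathbb{M}\models\phi\vdash\psi$ iff $[\![\phi]\!]\subseteq[\![\psi]\!]$. Construction of $\mathbb{M}_{\varphi,\psi}$: let $\Phi_0$ consist of $\top,\bot$ and all subformulas of $\varphi,\psi$; $\Phi_1=\Phi_0\cup\{\Box_i\sigma\mid\sigma\in\Phi_0, i\in\mathsf{Ag}\}$; $\Phi=\{\bigwedge\Psi\mid\Psi\subseteq\Phi_1\}$ (finite). On the set $A$ of filters and $X$ of ideals of the Lindenbaum–Tarski algebra of $\mathbf{L}_C$, set $a\equiv_\Phi b$ iff $a\cap\Phi=b\cap\Phi$ and $x\equiv_\Phi y$ iff $x\cap\Phi=y\cap\Phi$. Each class $\overline{a}$ is identified with a principal $\Phi$-filter, generated by some $\tau_{\overline{a}}\in\Phi$,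 and each $\overline{x}$ with a $\Phi$-ideal. Put $\Box^\ast_i\overline{x}=\{\Box_i\sigma\mid\sigma\in\overline{x}\}\cap\Phi$. Then $\mathbb{M}_{\varphi,\psi}=(A/{\equiv_\Phi},X/{\equiv_\Phi},I_{\varphi,\psi},\{R^{\varphi,\psi}_i\},V_{\varphi,\psi})$ with $\overline{a}I_{\varphi,\psi}\overline{x}$ iff $\tau_{\overline{a}}\in\overline{x}$, $\overline{a}R^{\varphi,\psi}_i\overline{x}$ iff $\Box^\ast_i\overline{x}\cap\overline{a}\neq\varnothing$, and $[\![p]\!]=\{\overline{a}\mid p\in\overline{a}\}$, $(\![p]\!)=\{\overline{x}\mid p\in\overline{x}\}$ for $p\in\mathsf{Prop}\cap\Phi$. -}

module Defs where

open import Level using (Lift; lift) renaming (suc to lsuc)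
open import Data.Nat using (ℕ)
open import Data.Fin using (Fin)
open import Data.List using (List; []; _∷_; map; allFin)
open import Data.List.Relation.Unary.All using (All)
open import Data.Product using (Σ; ∃; _×_; _,_)
open import Data.Sum using (_⊎_)
open import Data.Unit using (⊤)
open import Relation.Binary.PropositionalEquality using (_≡_)
open import Relation.Nullary using (¬_)

data Fm (Prop : Set) (n : ℕ) : Set where
  fbot ftop : Fm Prop n
  atom      : Prop → Fm Prop n
  _∧ᶠ_ _∨ᶠ_ : Fm Prop n → Fm Prop n → Fm Prop n
  □         : Fin n → Fm Prop n → Fm Prop n
  C         : Fm Prop n → Fm Prop n

infixr 6 _∧ᶠ_
infixr 5 _∨ᶠ_

module _ {Prop : Set} {n : ℕ} where

  bigAnd : List (Fm Prop n) → Fm Prop n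
  bigAnd []           = ftop
  bigAnd (x ∷ [])     = x
  bigAnd (x ∷ y ∷ ys) = x ∧ᶠ bigAnd (y ∷ ys)

  substF : (Prop → Fm Prop n) → Fm Prop n → Fm Prop n
  substF σ fbot       = fbot
  substF σ ftop       = ftop
  substF σ (atom p)   = σ p
  substF σ (φ ∧ᶠ ψ)   = substF σ φ ∧ᶠ substF σ ψ
  substF σ (φ ∨ᶠ ψ)   = substF σ φ ∨ᶠ substF σ ψ
  substF σ (□ i φ)    = □ i (substF σ φ)
  substF σ (C φ)      = C (substF σ φ)

  everyoneC : Fm Prop n → Fm Prop n
  everyoneC φ = bigAnd (map (λ i → □ i φ ∧ᶠ □ i (C φ)) (allFin n))

  everyone : Fm Prop n → Fm Prop n
  everyone φ = bigAnd (map (λ i → □ i φ) (allFin n))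

  -- The logic L_C: derivable sequents φ ⊢ ψ
  -- (axioms given as schemata; closure under uniform substitution is
  --  also included as a rule)

  data Der : Fm Prop n → Fm Prop n → Set where
    ax-id    : ∀ {p} → Der p p
    ax-bot   : ∀ {p} → Der fbot p
    ax-top   : ∀ {p} → Der p ftop
    ax-orl   : ∀ {p q} → Der p (p ∨ᶠ q)
    ax-orr   : ∀ {p q} → Der q (p ∨ᶠ q)
    ax-andl  : ∀ {p q} → Der (p ∧ᶠ q) p
    ax-andr  : ∀ {p q} → Der (p ∧ᶠ q) q
    ax-□top  : ∀ {i} → Der ftop (□ i ftop)
    ax-□and  : ∀ {i p q} → Der (□ i p ∧ᶠ □ i q) (□ i (p ∧ᶠ q))
    ax-Ctop  : Der ftop (C ftop)
    ax-Cand  : ∀ {p q} → Der (C p ∧ᶠ C q) (C (p ∧ᶠ q))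
    ax-Cunf  : ∀ {p} → Der (C p) (everyoneC p)
    cut      : ∀ {φ ψ χ} → Der φ ψ → Der ψ χ → Der φ χ
    usubst   : ∀ {φ ψ} (σ : Prop → Fm Prop n) → Der φ ψ → Der (substF σ φ) (substF σ ψ)
    and-R    : ∀ {χ φ ψ} → Der χ φ → Der χ ψ → Der χ (φ ∧ᶠ ψ)
    or-L     : ∀ {φ ψ χ} → Der φ χ → Der ψ χ → Der (φ ∨ᶠ ψ) χ
    mono-□   : ∀ {i φ ψ} → Der φ ψ → Der (□ i φ) (□ i ψ)
    mono-C   : ∀ {φ ψ} → Der φ ψ → Der (C φ) (C ψ)
    C-ind    : ∀ {χ φ} → Der χ (everyone φ) → (∀ i → Der χ (□ i χ)) → Der χ (C φ)

  record Model : Set₂ where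
    field
      A X  : Set₁
      I    : A → X → Set₁
      R    : Fin n → A → X → Set₁
      Vext : Prop → A → Set₁
      Vdes : Prop → X → Set₁

  module Sem (M : Model) where
    open Model M

    up : (A → X → Set₁) → (A → Set₁) → X → Set₁
    up S B x = ∀ a → B a → S a x

    down : (A → X → Set₁) → (X → Set₁) → A → Set₁
    down S Y a = ∀ x → Y x → S a x

    closure : X → X → Set₁
    closure x = up I (down I (λ y → y ≡ x))

    -- R_s for the nonempty sequence s = i ∷ t
    Rseq : Fin n → List (Fin n) → A → X → Set₁
    Rseq i []      = R i
    Rseq i (j ∷ t) a x = down (R i) (up I (down (Rseq j t) (closure x))) a

    RC : A → X → Set₁
    RC a x = ∀ i t → Rseq i t a x

    mutual
      ext : Fm Prop n → A → Set₁
      ext fbot     = down I (des fbot)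
      ext ftop     = λ _ → Lift _ ⊤
      ext (atom p) = Vext p
      ext (φ ∧ᶠ ψ) = λ a → ext φ a × ext ψ a
      ext (φ ∨ᶠ ψ) = down I (λ x → des φ x × des ψ x)
      ext (□ i φ)  = down (R i) (des φ)
      ext (C φ)    = down RC (des φ)

      des : Fm Prop n → X → Set₁
      des fbot     = λ _ → Lift _ ⊤
      des ftop     = up I (λ _ → Lift _ ⊤)
      des (atom p) = Vdes p
      des (φ ∧ᶠ ψ) = up I (λ a → ext φ a × ext ψ a)
      des (φ ∨ᶠ ψ) = λ x → des φ x × des ψ x
      des (□ i φ)  = up I (down (R i) (des φ))
      des (C φ)    = up I (down RC (des φ))

  _⊨_⊢_ : Model → Fm Prop n → Fm Prop n → Set₁
  M ⊨ φ ⊢ ψ = ∀ a → ext φ a → ext ψ a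
    where open Sem M

  -- Filters and ideals of the Lindenbaum–Tarski algebra of L_C

  record Filter : Set₁ where
    field
      mem    : Fm Prop n → Set
      mem-top : mem ftop
      mem-up  : ∀ {φ ψ} → mem φ → Der φ ψ → mem ψ
      mem-and : ∀ {φ ψ} → mem φ → mem ψ → mem (φ ∧ᶠ ψ)

  record Ideal : Set₁ where
    field
      mem     : Fm Prop n → Set
      mem-bot : mem fbot
      mem-down : ∀ {φ ψ} → mem ψ → Der φ ψ → mem φ
      mem-or  : ∀ {φ ψ} → mem φ → mem ψ → mem (φ ∨ᶠ ψ)

  data Sub : Fm Prop n → Fm Prop n → Set where
    sub-refl : ∀ {φ} → Sub φ φ
    sub-∧l   : ∀ {χ φ ψ} → Sub χ φ → Sub χ (φ ∧ᶠ ψ)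
    sub-∧r   : ∀ {χ φ ψ} → Sub χ ψ → Sub χ (φ ∧ᶠ ψ)
    sub-∨l   : ∀ {χ φ ψ} → Sub χ φ → Sub χ (φ ∨ᶠ ψ)
    sub-∨r   : ∀ {χ φ ψ} → Sub χ ψ → Sub χ (φ ∨ᶠ ψ)
    sub-□    : ∀ {χ i φ} → Sub χ φ → Sub χ (□ i φ)
    sub-C    : ∀ {χ φ} → Sub χ φ → Sub χ (C φ)

  Φ₀ : Fm Prop n → Fm Prop n → Fm Prop n → Set
  Φ₀ φ ψ χ = (χ ≡ ftop) ⊎ (χ ≡ fbot) ⊎ Sub χ φ ⊎ Sub χ ψ

  Φ₁ : Fm Prop n → Fm Prop n → Fm Prop n → Set
  Φ₁ φ ψ χ = Φ₀ φ ψ χ ⊎ (Σ (Fin n) λ i → Σ (Fm Prop n) λ σ → Φ₀ φ ψ σ × (χ ≡ □ i σ))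

  Φ : Fm Prop n → Fm Prop n → Fm Prop n → Set
  Φ φ ψ χ = Σ (List (Fm Prop n)) λ Ψ → All (Φ₁ φ ψ) Ψ × (χ ≡ bigAnd Ψ)

  -- t ∈ Φ generates the principal Φ-filter a ∩ Φ (i.e. t = τ_ā)
  IsGen : Fm Prop n → Fm Prop n → Filter → Fm Prop n → Set
  IsGen φ ψ a t = Φ φ ψ t ×
    (∀ χ → Φ φ ψ χ → (Filter.mem a χ → Der t χ) × (Der t χ → Filter.mem a χ))

  -- The model M_{φ,ψ}, given a choice τ of generators.
  -- Classes of ≡_Φ are represented by their members; all relations below
  -- are ≡_Φ-invariant.

  M[_,_] : (φ ψ : Fm Prop n) → (τ : Filter → Fm Prop n) → Model
  M[ φ , ψ ] τ = record
    { A    = Filter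
    ; X    = Ideal
    ; I    = λ a x → Lift _ (Ideal.mem x (τ a))
    ; R    = λ i a x → Lift _ (Σ (Fm Prop n) λ σ →
                 Φ φ ψ σ × Ideal.mem x σ × Φ φ ψ (□ i σ) × Filter.mem a (□ i σ))
    ; Vext = λ p a → Lift _ (Filter.mem a (atom p))
    ; Vdes = λ p x → Lift _ (Ideal.mem x (atom p))
    }

-- The proof is a truth lemma: for every subformula χ of φ or ψ, a class ā
-- lies in [[χ]] iff χ ∈ ā, and x̄ lies in (|χ|) iff χ ∈ x̄.  Evaluated at the
-- principal filter ↑φ it turns M ⊨ φ ⊢ ψ into a derivation of φ ⊢ ψ.
--
-- Everything except common knowledge is routine bookkeeping with Φ.  To
-- show C(χ) ∈ ā from ā R_C ↓χ we produce a C-invariant: what each R_s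
-- forces at the principal ideal ↓χ is a formula ⋁{□_i σ | σ ∈ L, σ ⊢ θ}
-- (L a finite list containing Φ₀), determined by a node (i, subset of L).  The conjunction of the formulas of all nodes
-- reachable from χ entails □_i of itself and every □_i χ, so the induction
-- rule yields C(χ).  Knowing the subsets and the reachable nodes needs
-- finitely many instances of excluded middle; since the theorem is a
-- negation these are available under double negation.

module Submission where

open import Defs
open import Data.Nat using (ℕ)
open import Relation.Nullary using (¬_)

open import Level using (lift; lower; 0ℓ)
open import Data.Bool using (Bool; true; false)
open import Data.Empty using (⊥-elim)
open import Data.Fin using (Fin)
open import Data.Vec using (Vec; []; _∷_)
open import Data.List using (List; []; _∷_; _++_; map; allFin; filter; cartesianProduct; length)
import Data.List.Relation.Unary.All as All
open import Data.List.Relation.Unary.Any using (here; there)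
open import Data.List.Membership.Propositional using (_∈_)
open import Data.List.Membership.Propositional.Properties
  using (∈-map⁺; ∈-map⁻; ∈-++⁺ˡ; ∈-++⁺ʳ; ∈-filter⁺; ∈-filter⁻; ∈-allFin; ∈-cartesianProduct⁺)
open import Data.Product using (Σ; _×_; _,_; proj₁; proj₂)
open import Data.Sum using (_⊎_; inj₁; inj₂)
open import Data.Unit using (tt)
open import Effect.Monad using (RawMonad)
open import Function.Bundles using (_⇔_; mk⇔; Equivalence)
open import Relation.Nullary using (Dec; yes; no)
open import Relation.Nullary.Decidable using (¬¬-excluded-middle)
open import Relation.Nullary.Negation using (¬¬-map; ¬¬-Monad)
open import Relation.Binary.PropositionalEquality using (refl)

open Equivalence using (to; from)

module Classical {A : Set} where

  ¬¬-∀∈ : {P : A → Set} {xs : List A} →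
          (∀ {x} → x ∈ xs → ¬ ¬ P x) → ¬ ¬ (∀ {x} → x ∈ xs → P x)
  ¬¬-∀∈ f = ¬¬-map All.lookup (All.sequenceM 0ℓ ¬¬-Monad (All.tabulate f))

  ¬¬-∀ : {P : A → Set} (xs : List A) → (∀ x → x ∈ xs) →
         (∀ x → ¬ ¬ P x) → ¬ ¬ (∀ x → P x)
  ¬¬-∀ xs complete f = ¬¬-map (λ g x → g (complete x)) (¬¬-∀∈ (λ {x} _ → f x))

  Listing : (A → Set) → Set
  Listing P = Σ (List A) λ ys → (∀ {x} → P x → x ∈ ys) × (∀ {x} → x ∈ ys → P x)

  ¬¬-listing : {P : A → Set} (xs : List A) → (∀ x → x ∈ xs) → ¬ ¬ Listing P
  ¬¬-listing xs complete = ¬¬-map listing (¬¬-∀ xs complete (λ _ → ¬¬-excluded-middle))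
    where
      listing : ∀ {P} → (∀ x → Dec (P x)) → Listing P
      listing P? = filter P? xs
                 , (λ p → ∈-filter⁺ P? (complete _) p)
                 , (λ q → proj₂ (∈-filter⁻ P? {xs = xs} q))

open Classical

module CharacteristicVectors {A : Set} where

  select : (L : List A) → Vec Bool (length L) → List A
  select []      []          = []
  select (x ∷ L) (true ∷ U)  = x ∷ select L U
  select (x ∷ L) (false ∷ U) = select L U

  Characterises : (L : List A) → Vec Bool (length L) → (A → Set) → Set
  Characterises L U P =
    (∀ {x} → x ∈ select L U → P x) × (∀ {x} → x ∈ L → P x → x ∈ select L U)

  characteristic : {P : A → Set} (L : List A) → (∀ {x} → x ∈ L → Dec (P x)) →
                   Σ (Vec Bool (length L)) λ U → Characterises L U P
  characteristic []      P? = [] , (λ ()) , (λ ())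
  characteristic (x ∷ L) P? with P? (here refl) | characteristic L (λ q → P? (there q))
  ... | yes p  | U , sound , complete =
    (true ∷ U) , (λ { (here refl) → p ; (there q) → sound q })
               , (λ { (here refl) _ → here refl ; (there q) px → there (complete q px) })
  ... | no ¬p | U , sound , complete =
    (false ∷ U) , sound , (λ { (here refl) px → ⊥-elim (¬p px) ; (there q) px → complete q px })

open CharacteristicVectors

vectors : ∀ k → List (Vec Bool k)
vectors ℕ.zero    = [] ∷ []
vectors (ℕ.suc k) = map (true ∷_) (vectors k) ++ map (false ∷_) (vectors k)

vectors-complete : ∀ {k} (U : Vec Bool k) → U ∈ vectors k
vectors-complete []          = here refl
vectors-complete (true ∷ U)  = ∈-++⁺ˡ (∈-map⁺ (true ∷_) (vectors-complete U))
vectors-complete {ℕ.suc k} (false ∷ U) =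
  ∈-++⁺ʳ (map (true ∷_) (vectors k)) (∈-map⁺ (false ∷_) (vectors-complete U))

module DerivedRules {Prop : Set} {n : ℕ} where

  private
    F : Set
    F = Fm Prop n

  ⋁ : List F → F
  ⋁ []       = fbot
  ⋁ (x ∷ xs) = x ∨ᶠ ⋁ xs

  ⋁-in : ∀ {x : F} {xs} → x ∈ xs → Der x (⋁ xs)
  ⋁-in (here refl) = ax-orl
  ⋁-in (there p)   = cut (⋁-in p) ax-orr

  ⋁-elim : ∀ {θ} xs → (∀ {x} → x ∈ xs → Der x θ) → Der (⋁ xs) θ
  ⋁-elim []       f = ax-bot
  ⋁-elim (x ∷ xs) f = or-L (f (here refl)) (⋁-elim xs (λ p → f (there p)))

  ⋀-out : ∀ {x : F} {xs} → x ∈ xs → Der (bigAnd xs) x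
  ⋀-out {xs = x ∷ []}     (here refl) = ax-id
  ⋀-out {xs = x ∷ y ∷ ys} (here refl) = ax-andl
  ⋀-out {xs = x ∷ y ∷ ys} (there p)   = cut ax-andr (⋀-out p)

  ⋀-in : {A : Set} {θ : F} (f : A → F) (xs : List A) →
         (∀ {x} → x ∈ xs → Der θ (f x)) → Der θ (bigAnd (map f xs))
  ⋀-in f []           g = ax-top
  ⋀-in f (x ∷ [])     g = g (here refl)
  ⋀-in f (x ∷ y ∷ ys) g = and-R (g (here refl)) (⋀-in f (y ∷ ys) (λ p → g (there p)))

  ⋀□⊢□⋀ : {A : Set} (i : Fin n) (f : A → F) (xs : List A) →
          Der (bigAnd (map (λ x → □ i (f x)) xs)) (□ i (bigAnd (map f xs)))
  ⋀□⊢□⋀ i f []           = ax-□top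
  ⋀□⊢□⋀ i f (x ∷ [])     = ax-id
  ⋀□⊢□⋀ i f (x ∷ y ∷ ys) = cut (and-R ax-andl (cut ax-andr (⋀□⊢□⋀ i f (y ∷ ys)))) ax-□and

  C⊢□ : ∀ {χ} i → Der (C χ) (□ i χ)
  C⊢□ {χ} i = cut ax-Cunf (cut (⋀-out (∈-map⁺ (λ i → □ i χ ∧ᶠ □ i (C χ)) (∈-allFin i))) ax-andl)

  C⊢□C : ∀ {χ} i → Der (C χ) (□ i (C χ))
  C⊢□C {χ} i = cut ax-Cunf (cut (⋀-out (∈-map⁺ (λ i → □ i χ ∧ᶠ □ i (C χ)) (∈-allFin i))) ax-andr)

  ↑_ : F → Filter
  ↑ θ = record { mem = Der θ ; mem-top = ax-top ; mem-up = cut ; mem-and = and-R }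

  ↓_ : F → Ideal
  ↓ θ = record { mem = λ σ → Der σ θ ; mem-bot = ax-bot ; mem-down = λ d e → cut e d ; mem-or = or-L }

open DerivedRules

module Reachability {Prop : Set} {n : ℕ} (L : List (Fm Prop n)) where

  private
    F : Set
    F = Fm Prop n

  Code : Set
  Code = Vec Bool (length L)

  Codes : Code → F → Set
  Codes U θ = Characterises L U (λ σ → Der σ θ)

  □⋁ : Fin n → Code → F
  □⋁ i U = ⋁ (map (□ i) (select L U))

  □⋁-bound : ∀ {θ} i {U} → Codes U θ → Der (□⋁ i U) (□ i θ)
  □⋁-bound i {U} (sound , _) = ⋁-elim (map (□ i) (select L U)) boxed
    where
      boxed : ∀ {x} → x ∈ map (□ i) (select L U) → Der x (□ i _)
      boxed p with ∈-map⁻ (□ i) p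
      ... | σ , q , refl = mono-□ (sound q)

  □⋁-hit : ∀ {θ σ} i U → Codes U θ → σ ∈ L → Der σ θ → Der (□ i σ) (□⋁ i U)
  □⋁-hit i U (_ , complete) σ∈L σ⊢θ = ⋁-in (∈-map⁺ (□ i) (complete σ∈L σ⊢θ))

  Node : Set
  Node = Fin n × Code

  nodes : List Node
  nodes = cartesianProduct (allFin n) (vectors (length L))

  nodes-complete : ∀ e → e ∈ nodes
  nodes-complete (i , U) = ∈-cartesianProduct⁺ (∈-allFin i) (vectors-complete U)

  node□⋁ : Node → F
  node□⋁ e = □⋁ (proj₁ e) (proj₂ e)

  data Reach (χ : F) : Node → Set where
    base : ∀ {i U} → Codes U χ → Reach χ (i , U)
    step : ∀ {i j U U'} → Reach χ (j , U) → Codes U' (□⋁ j U) → Reach χ (i , U')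

  -- The finitely many classical facts the C-invariant needs: codes of the
  -- formulas of L and of all □⋁-formulas, and the list of reachable nodes.
  record Decisions : Set where
    field
      code      : ∀ {θ} → θ ∈ L → Σ Code λ U → Codes U θ
      code□⋁    : ∀ e → Σ Code λ U → Codes U (node□⋁ e)
      reachable : ∀ {χ} → χ ∈ L → Listing (Reach χ)

  ¬¬-code : ∀ θ → ¬ ¬ (Σ Code λ U → Codes U θ)
  ¬¬-code θ = ¬¬-map (characteristic L) (¬¬-∀∈ (λ _ → ¬¬-excluded-middle))

  decisions : ¬ ¬ Decisions
  decisions = do
    code      ← ¬¬-∀∈ (λ {θ} _ → ¬¬-code θ)
    code□⋁    ← ¬¬-∀ nodes nodes-complete (λ e → ¬¬-code (node□⋁ e))
    reachable ← ¬¬-∀∈ (λ _ → ¬¬-listing nodes nodes-complete)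
    pure (record { code = code ; code□⋁ = code□⋁ ; reachable = reachable })
    where open RawMonad ¬¬-Monad

  module Invariant (d : Decisions) {χ : F} (χ∈L : χ ∈ L) where
    open Decisions d

    reached : List Node
    reached = proj₁ (reachable χ∈L)

    reached-complete : ∀ {e} → Reach χ e → e ∈ reached
    reached-complete = proj₁ (proj₂ (reachable χ∈L))

    reached-sound : ∀ {e} → e ∈ reached → Reach χ e
    reached-sound = proj₂ (proj₂ (reachable χ∈L))

    invariant : F
    invariant = bigAnd (map node□⋁ reached)

    invariant⊢ : ∀ {e} → Reach χ e → Der invariant (node□⋁ e)
    invariant⊢ r = ⋀-out (∈-map⁺ node□⋁ (reached-complete r))

    ⊢invariant : ∀ {θ} → (∀ {e} → Reach χ e → Der θ (node□⋁ e)) → Der θ invariant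
    ⊢invariant f = ⋀-in node□⋁ reached (λ q → f (reached-sound q))

    -- Every node (i, code of χ) is reached, and its formula entails □_i χ.
    invariant⊢everyone : Der invariant (everyone χ)
    invariant⊢everyone = ⋀-in (λ i → □ i χ) (allFin n) χ-boxed
      where
        χ-boxed : ∀ {i} → i ∈ allFin n → Der invariant (□ i χ)
        χ-boxed {i} _ = cut (invariant⊢ (base {i = i} (proj₂ (code χ∈L))))
                            (□⋁-bound i (proj₂ (code χ∈L)))

    -- For a reached node e, the node (i, code of node□⋁ e) is reached too,
    -- and its formula entails □_i (node□⋁ e).
    invariant⊢□invariant : ∀ i → Der invariant (□ i invariant)
    invariant⊢□invariant i =
      cut (⋀-in (λ e → □ i (node□⋁ e)) reached successor) (⋀□⊢□⋀ i node□⋁ reached)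
      where
        successor : ∀ {e} → e ∈ reached → Der invariant (□ i (node□⋁ e))
        successor {e} q = cut (invariant⊢ (step {i = i} (reached-sound q) (proj₂ (code□⋁ e))))
                              (□⋁-bound i (proj₂ (code□⋁ e)))

    invariant⊢C : Der invariant (C χ)
    invariant⊢C = C-ind invariant⊢everyone invariant⊢□invariant

module SubformulaList {Prop : Set} {n : ℕ} where

  private
    F : Set
    F = Fm Prop n

  sub-trans : ∀ {χ₁ χ₂ χ₃ : F} → Sub χ₁ χ₂ → Sub χ₂ χ₃ → Sub χ₁ χ₃
  sub-trans p sub-refl   = p
  sub-trans p (sub-∧l q) = sub-∧l (sub-trans p q)
  sub-trans p (sub-∧r q) = sub-∧r (sub-trans p q)
  sub-trans p (sub-∨l q) = sub-∨l (sub-trans p q)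
  sub-trans p (sub-∨r q) = sub-∨r (sub-trans p q)
  sub-trans p (sub-□ q)  = sub-□ (sub-trans p q)
  sub-trans p (sub-C q)  = sub-C (sub-trans p q)

  subformulas : F → List F
  subformulas fbot     = fbot ∷ []
  subformulas ftop     = ftop ∷ []
  subformulas (atom p) = atom p ∷ []
  subformulas (a ∧ᶠ b) = (a ∧ᶠ b) ∷ subformulas a ++ subformulas b
  subformulas (a ∨ᶠ b) = (a ∨ᶠ b) ∷ subformulas a ++ subformulas b
  subformulas (□ i a)  = □ i a ∷ subformulas a
  subformulas (C a)    = C a ∷ subformulas a

  self∈subformulas : ∀ χ → χ ∈ subformulas χ
  self∈subformulas fbot     = here refl
  self∈subformulas ftop     = here refl
  self∈subformulas (atom p) = here refl
  self∈subformulas (a ∧ᶠ b) = here refl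
  self∈subformulas (a ∨ᶠ b) = here refl
  self∈subformulas (□ i a)  = here refl
  self∈subformulas (C a)    = here refl

  Sub⇒∈subformulas : ∀ {σ χ} → Sub σ χ → σ ∈ subformulas χ
  Sub⇒∈subformulas {χ = χ} sub-refl = self∈subformulas χ
  Sub⇒∈subformulas (sub-∧l p) = there (∈-++⁺ˡ (Sub⇒∈subformulas p))
  Sub⇒∈subformulas {χ = a ∧ᶠ b} (sub-∧r p) = there (∈-++⁺ʳ (subformulas a) (Sub⇒∈subformulas p))
  Sub⇒∈subformulas (sub-∨l p) = there (∈-++⁺ˡ (Sub⇒∈subformulas p))
  Sub⇒∈subformulas {χ = a ∨ᶠ b} (sub-∨r p) = there (∈-++⁺ʳ (subformulas a) (Sub⇒∈subformulas p))
  Sub⇒∈subformulas (sub-□ p) = there (Sub⇒∈subformulas p)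
  Sub⇒∈subformulas (sub-C p) = there (Sub⇒∈subformulas p)

open SubformulaList

module FiniteΦ {Prop : Set} {n : ℕ} (φ ψ : Fm Prop n) where

  private
    F : Set
    F = Fm Prop n

  IsSub : F → Set
  IsSub χ = Sub χ φ ⊎ Sub χ ψ

  IsSub-sub : ∀ {χ' χ} → Sub χ' χ → IsSub χ → IsSub χ'
  IsSub-sub p (inj₁ q) = inj₁ (sub-trans p q)
  IsSub-sub p (inj₂ q) = inj₂ (sub-trans p q)

  IsSub⇒Φ₀ : ∀ {χ} → IsSub χ → Φ₀ φ ψ χ
  IsSub⇒Φ₀ (inj₁ p) = inj₂ (inj₂ (inj₁ p))
  IsSub⇒Φ₀ (inj₂ p) = inj₂ (inj₂ (inj₂ p))

  IsSub⇒Φ : ∀ {χ} → IsSub χ → Φ φ ψ χ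
  IsSub⇒Φ s = (_ ∷ []) , (inj₁ (IsSub⇒Φ₀ s) All.∷ All.[]) , refl

  IsSub⇒Φ□ : ∀ {χ} i → IsSub χ → Φ φ ψ (□ i χ)
  IsSub⇒Φ□ i s = (_ ∷ []) , (inj₂ (i , _ , IsSub⇒Φ₀ s , refl) All.∷ All.[]) , refl

  Φ□⇒Φ₀ : ∀ {i σ} → Φ φ ψ (□ i σ) → Φ₀ φ ψ σ
  Φ□⇒Φ₀ ((_ ∷ []) , (inj₁ (inj₁ ()) All.∷ All.[]) , refl)
  Φ□⇒Φ₀ ((_ ∷ []) , (inj₁ (inj₂ (inj₁ ())) All.∷ All.[]) , refl)
  Φ□⇒Φ₀ ((_ ∷ []) , (inj₁ (inj₂ (inj₂ (inj₁ s))) All.∷ All.[]) , refl) =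
    inj₂ (inj₂ (inj₁ (sub-trans (sub-□ sub-refl) s)))
  Φ□⇒Φ₀ ((_ ∷ []) , (inj₁ (inj₂ (inj₂ (inj₂ s))) All.∷ All.[]) , refl) =
    inj₂ (inj₂ (inj₂ (sub-trans (sub-□ sub-refl) s)))
  Φ□⇒Φ₀ ((_ ∷ []) , (inj₂ (_ , _ , p , refl) All.∷ All.[]) , refl) = p
  Φ□⇒Φ₀ ([] , _ , ())
  Φ□⇒Φ₀ ((_ ∷ _ ∷ _) , _ , ())

  Φ₀-list : List F
  Φ₀-list = ftop ∷ fbot ∷ subformulas φ ++ subformulas ψ

  Φ₀⇒∈list : ∀ {σ} → Φ₀ φ ψ σ → σ ∈ Φ₀-list
  Φ₀⇒∈list (inj₁ refl)            = here refl
  Φ₀⇒∈list (inj₂ (inj₁ refl))     = there (here refl)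
  Φ₀⇒∈list (inj₂ (inj₂ (inj₁ p))) = there (there (∈-++⁺ˡ (Sub⇒∈subformulas p)))
  Φ₀⇒∈list (inj₂ (inj₂ (inj₂ p))) = there (there (∈-++⁺ʳ (subformulas φ) (Sub⇒∈subformulas p)))

module CanonicalModel {Prop : Set} {n : ℕ} (φ ψ : Fm Prop n)
         (τ : Filter {Prop} {n} → Fm Prop n) (gen : ∀ a → IsGen φ ψ a (τ a)) where

  open FiniteΦ φ ψ
  open Reachability Φ₀-list

  private
    F : Set
    F = Fm Prop n

  _∈ᶠ_ : F → Filter {Prop} {n} → Set
  θ ∈ᶠ a = Filter.mem a θ

  _∈ⁱ_ : F → Ideal {Prop} {n} → Set
  θ ∈ⁱ x = Ideal.mem x θ

  M : Model
  M = M[ φ , ψ ] τ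

  open Model M using (I; R)
  open Sem M

  τ-entails : ∀ {θ} a → Φ φ ψ θ → θ ∈ᶠ a → Der (τ a) θ
  τ-entails {θ} a Φθ = proj₁ (proj₂ (gen a) θ Φθ)

  τ-generates : ∀ {θ} a → Der (τ a) θ → θ ∈ᶠ a
  τ-generates a = Filter.mem-up a (proj₂ (proj₂ (gen a) (τ a) (proj₁ (gen a))) ax-id)

  τ-below : ∀ {θ} a x → Φ φ ψ θ → θ ∈ᶠ a → θ ∈ⁱ x → τ a ∈ⁱ x
  τ-below a x Φθ θ∈a θ∈x = Ideal.mem-down x θ∈x (τ-entails a Φθ θ∈a)

  τ↑-below : ∀ θ x → τ (↑ θ) ∈ⁱ x → θ ∈ⁱ x
  τ↑-below θ x τ∈x = Ideal.mem-down x τ∈x (τ-generates (↑ θ) ax-id)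

  up-truth : ∀ {χ} {E : Filter → Set₁} → Φ φ ψ χ →
             (∀ a → E a ⇔ χ ∈ᶠ a) → ∀ x → up I E x ⇔ χ ∈ⁱ x
  up-truth {χ} Φχ E⇔ x = mk⇔
    (λ u → τ↑-below χ x (lower (u (↑ χ) (from (E⇔ (↑ χ)) ax-id))))
    (λ χ∈x a e → lift (τ-below a x Φχ (to (E⇔ a) e) χ∈x))

  down-truth : ∀ {χ} {D : Ideal → Set₁} → Φ φ ψ χ →
               (∀ x → D x ⇔ χ ∈ⁱ x) → ∀ a → down I D a ⇔ χ ∈ᶠ a
  down-truth {χ} Φχ D⇔ a = mk⇔
    (λ d → τ-generates a (lower (d (↓ χ) (from (D⇔ (↓ χ)) ax-id))))
    (λ χ∈a x e → lift (τ-below a x Φχ χ∈a (to (D⇔ x) e)))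

  closure-refl : ∀ x → closure x x
  closure-refl x c k = k x refl

  closure-mem : ∀ {θ} z w → Φ φ ψ θ → θ ∈ⁱ z → closure z w → θ ∈ⁱ w
  closure-mem {θ} z w Φθ θ∈z w∈cl =
    τ↑-below θ w (lower (w∈cl (↑ θ) (λ { _ refl → lift (τ-below (↑ θ) z Φθ ax-id θ∈z) })))

  R↓⇒□ : ∀ {i} a θ → R i a (↓ θ) → □ i θ ∈ᶠ a
  R↓⇒□ a θ (lift (σ , _ , σ⊢θ , _ , □σ∈a)) = Filter.mem-up a □σ∈a (mono-□ σ⊢θ)

  R↓⇒□⋁ : ∀ {i} c θ U → R i c (↓ θ) → Codes U θ → Der (τ c) (□⋁ i U)
  R↓⇒□⋁ {i} c θ U (lift (σ , _ , σ⊢θ , Φ□σ , □σ∈c)) U-codes =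
    cut (τ-entails c Φ□σ □σ∈c) (□⋁-hit i U U-codes (Φ₀⇒∈list (Φ□⇒Φ₀ Φ□σ)) σ⊢θ)

  reach-forces : ∀ {χ e} → Reach χ e →
                 Σ (List (Fin n)) λ t → ∀ c → Rseq (proj₁ e) t c (↓ χ) → Der (τ c) (node□⋁ e)
  reach-forces {χ} (base {U = U} U-codes) = [] , λ c r → R↓⇒□⋁ c χ U r U-codes
  reach-forces {χ} (step {j = j} {U = U} {U' = U'} r U'-codes) with reach-forces r
  ... | t , forces = (j ∷ t) , λ c r' → R↓⇒□⋁ c (□⋁ j U) U' (r' (↓ (□⋁ j U)) below) U'-codes
    where
      below : ∀ b → down (Rseq j t) (closure (↓ χ)) b → I b (↓ (□⋁ j U))
      below b b-forces = lift (forces b (b-forces (↓ χ) (closure-refl (↓ χ))))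

  record Truth (χ : F) : Set₁ where
    field
      ext⇔ : ∀ a → ext χ a ⇔ χ ∈ᶠ a
      des⇔ : ∀ x → des χ x ⇔ χ ∈ⁱ x

  □-ext⇔ : ∀ {i χ} → IsSub (□ i χ) → (∀ x → des χ x ⇔ χ ∈ⁱ x) →
           ∀ a → ext (□ i χ) a ⇔ □ i χ ∈ᶠ a
  □-ext⇔ {i} {χ} s des⇔χ a = mk⇔
    (λ e → R↓⇒□ a χ (e (↓ χ) (from (des⇔χ (↓ χ)) ax-id)))
    (λ □χ∈a x d → lift (χ , IsSub⇒Φ sχ , to (des⇔χ x) d , IsSub⇒Φ□ i sχ , □χ∈a))
    where
      sχ : IsSub χ
      sχ = IsSub-sub (sub-□ sub-refl) s

  C-mem⇒Rseq : ∀ {χ} → IsSub (C χ) → ∀ i t {b z} → C χ ∈ᶠ b → χ ∈ⁱ z → Rseq i t b z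
  C-mem⇒Rseq {χ} s i [] {b} Cχ∈b χ∈z =
    lift (χ , IsSub⇒Φ sχ , χ∈z , IsSub⇒Φ□ i sχ , Filter.mem-up b Cχ∈b (C⊢□ i))
    where
      sχ : IsSub χ
      sχ = IsSub-sub (sub-C sub-refl) s
  C-mem⇒Rseq {χ} s i (j ∷ t) {b} {z} Cχ∈b χ∈z y y-forces =
    lift (C χ , IsSub⇒Φ s , Cχ∈y , IsSub⇒Φ□ i s , Filter.mem-up b Cχ∈b (C⊢□C i))
    where
      Cχ∈y : C χ ∈ⁱ y
      Cχ∈y = τ↑-below (C χ) y (lower (y-forces (↑ C χ) (λ w w∈cl →
        C-mem⇒Rseq s j t ax-id (closure-mem z w (IsSub⇒Φ (IsSub-sub (sub-C sub-refl) s)) χ∈z w∈cl))))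

  -- Conversely, R_C a ↓χ gives τ a ⊢ invariant ⊢ C χ.
  ext⇒C-mem : Decisions → ∀ {χ} → IsSub (C χ) → (∀ x → des χ x ⇔ χ ∈ⁱ x) →
              ∀ a → ext (C χ) a → C χ ∈ᶠ a
  ext⇒C-mem d {χ} s des⇔χ a Cχ-ext = τ-generates a (cut (⊢invariant forced) invariant⊢C)
    where
      open Invariant d (Φ₀⇒∈list (IsSub⇒Φ₀ (IsSub-sub (sub-C sub-refl) s)))
      RC-a : RC a (↓ χ)
      RC-a = Cχ-ext (↓ χ) (from (des⇔χ (↓ χ)) ax-id)
      forced : ∀ {e} → Reach χ e → Der (τ a) (node□⋁ e)
      forced r = proj₂ (reach-forces r) a (RC-a _ (proj₁ (reach-forces r)))

  C-ext⇔ : Decisions → ∀ {χ} → IsSub (C χ) → (∀ x → des χ x ⇔ χ ∈ⁱ x) →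
           ∀ a → ext (C χ) a ⇔ C χ ∈ᶠ a
  C-ext⇔ d s des⇔χ a = mk⇔
    (ext⇒C-mem d s des⇔χ a)
    (λ Cχ∈a x d i t → C-mem⇒Rseq s i t Cχ∈a (to (des⇔χ x) d))

  truth : Decisions → ∀ χ → IsSub χ → Truth χ
  truth d fbot s = record { ext⇔ = down-truth (IsSub⇒Φ s) des⇔ ; des⇔ = des⇔ }
    where
      des⇔ : ∀ x → des fbot x ⇔ fbot ∈ⁱ x
      des⇔ x = mk⇔ (λ _ → Ideal.mem-bot x) (λ _ → lift tt)
  truth d ftop s = record { ext⇔ = ext⇔ ; des⇔ = up-truth (IsSub⇒Φ s) ext⇔ }
    where
      ext⇔ : ∀ a → ext ftop a ⇔ ftop ∈ᶠ a
      ext⇔ a = mk⇔ (λ _ → Filter.mem-top a) (λ _ → lift tt)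
  truth d (atom p) s = record { ext⇔ = λ a → mk⇔ lower lift ; des⇔ = λ x → mk⇔ lower lift }
  truth d (χ₁ ∧ᶠ χ₂) s = record { ext⇔ = ext⇔ ; des⇔ = up-truth (IsSub⇒Φ s) ext⇔ }
    where
      t₁ : Truth χ₁
      t₁ = truth d χ₁ (IsSub-sub (sub-∧l sub-refl) s)
      t₂ : Truth χ₂
      t₂ = truth d χ₂ (IsSub-sub (sub-∧r sub-refl) s)
      ext⇔ : ∀ a → ext (χ₁ ∧ᶠ χ₂) a ⇔ (χ₁ ∧ᶠ χ₂) ∈ᶠ a
      ext⇔ a = mk⇔
        (λ (e₁ , e₂) → Filter.mem-and a (to (Truth.ext⇔ t₁ a) e₁) (to (Truth.ext⇔ t₂ a) e₂))
        (λ m → from (Truth.ext⇔ t₁ a) (Filter.mem-up a m ax-andl)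
             , from (Truth.ext⇔ t₂ a) (Filter.mem-up a m ax-andr))
  truth d (χ₁ ∨ᶠ χ₂) s = record { ext⇔ = down-truth (IsSub⇒Φ s) des⇔ ; des⇔ = des⇔ }
    where
      t₁ : Truth χ₁
      t₁ = truth d χ₁ (IsSub-sub (sub-∨l sub-refl) s)
      t₂ : Truth χ₂
      t₂ = truth d χ₂ (IsSub-sub (sub-∨r sub-refl) s)
      des⇔ : ∀ x → des (χ₁ ∨ᶠ χ₂) x ⇔ (χ₁ ∨ᶠ χ₂) ∈ⁱ x
      des⇔ x = mk⇔
        (λ (d₁ , d₂) → Ideal.mem-or x (to (Truth.des⇔ t₁ x) d₁) (to (Truth.des⇔ t₂ x) d₂))
        (λ m → from (Truth.des⇔ t₁ x) (Ideal.mem-down x m ax-orl)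
             , from (Truth.des⇔ t₂ x) (Ideal.mem-down x m ax-orr))
  truth d (□ i χ) s = record { ext⇔ = ext⇔ ; des⇔ = up-truth (IsSub⇒Φ s) ext⇔ }
    where
      ext⇔ : ∀ a → ext (□ i χ) a ⇔ □ i χ ∈ᶠ a
      ext⇔ = □-ext⇔ s (Truth.des⇔ (truth d χ (IsSub-sub (sub-□ sub-refl) s)))
  truth d (C χ) s = record { ext⇔ = ext⇔ ; des⇔ = up-truth (IsSub⇒Φ s) ext⇔ }
    where
      ext⇔ : ∀ a → ext (C χ) a ⇔ C χ ∈ᶠ a
      ext⇔ = C-ext⇔ d s (Truth.des⇔ (truth d χ (IsSub-sub (sub-C sub-refl) s)))

  completeness : Decisions → M ⊨ φ ⊢ ψ → Der φ ψ
  completeness d valid =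
    to (Truth.ext⇔ (truth d ψ (inj₂ sub-refl)) (↑ φ))
       (valid (↑ φ) (from (Truth.ext⇔ (truth d φ (inj₁ sub-refl)) (↑ φ)) ax-id))

propositionA24 : {Prop : Set} {n : ℕ} (φ ψ : Fm Prop n) → ¬ Der φ ψ →
    (τ : Filter {Prop} {n} → Fm Prop n) → (∀ a → IsGen φ ψ a (τ a)) →
    ¬ (M[ φ , ψ ] τ ⊨ φ ⊢ ψ)
propositionA24 φ ψ ⊬φψ τ gen valid =
  Reachability.decisions (FiniteΦ.Φ₀-list φ ψ)
    (λ d → ⊬φψ (CanonicalModel.completeness φ ψ τ gen d valid))
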